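{- Let $r\ge 1$ and let $v$ be a vertex of the Kostka polytope $P_r$ labeled by the triple $(a,b,\ell)$. Then: (1) for $1\le i\le r$, $v\in H_i$ if and only if $b\neq i$; (2) for $1\le k<r$, $v\in\widehat H_k$ if and only if $a\neq k$ and $\ell\neq k$; (3) for $1\le j<r$, $v\in J_j$ if and only if $j\le\ell$, or $j\ge a$, or $a=b$.
   Context: For a positive integer $r$, a partition with at most $r$ parts is written as a non-increasing $r$-tuple of nonnegative integers; $\mathrm{Par}_r(n)$ is the set of those with entries summing to $n$. For $\lambda,\mu\in\mathrm{Par}_r(n)$, $\lambda$ dominates $\mu$ if $\sum_{i=1}^k\lambda_i\ge\sum_{i=1}^k\mu_i$ for all $k\le r$. The $r$-Kostka cone $\mathcal{K}_r\subseteq\mathbb{R}^{2r}$ is the convex hull of all points $(\lambda_1,\dots,\lambda_r,\mu_1,\dots,\mu_r)$ with $\lambda,\mu\in\mathrm{Par}_r(n)$ for some $n$ and $\lambda$ dominating $\mu$. The Kostka polytope $P_r$ is $\mathcal{K}_r\cap\{x:\sum_{i=1}^r(\lambda_i+\mu_i)=1\}$, whose vertices are the intersections with the extremal rays of $\mathcal{K}_r$. It is known that the extremal rays of $\mathcal{K}_r$ are exactly the rays spanned by the vectors $\big((a-\ell)^b,0^{r-b};\,(a-\ell)^\ell,(b-\ell)^{a-\ell},0^{r-a}\big)$ for integers $0\le\ell<b\le a\le r$, where exponents denote repetition of an entry. A vertex of $P_r$ on the ray of such a vector with $a\neq b$ (so $0\le\ell<b<a\le r$) is labeled $(a,b,\ell)$;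 when $a=b$ the ray does not depend on $\ell$, and the vertex is labeled $(a,a,a)$. In coordinates $(\lambda_1,\dots,\lambda_r,\mu_1,\dots,\mu_r)$ of $\mathbb{R}^{2r}$ define the hyperplanes $H_i=\{\lambda_i=\lambda_{i+1}\}$ for $1\le i<r$, $H_r=\{\lambda_r=0\}$, $\widehat H_i=\{\mu_i=\mu_{i+1}\}$ for $1\le i<r$, and $J_i=\{\sum_{j=1}^i\lambda_j=\sum_{j=1}^i\mu_j\}$ for $1\le i<r$. -}

module Defs where

open import Data.Nat using (ℕ; zero; suc; _∸_; _≤_; _<_; _≤ᵇ_; _<ᵇ_)
open import Data.Bool using (if_then_else_)
open import Data.Integer using (+_)
open import Data.Rational using (ℚ; _/_; _+_; _*_; 0ℚ; 1ℚ) renaming (_<_ to _<ℚ_)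
open import Data.Product using (Σ; _×_)
open import Relation.Binary.PropositionalEquality using (_≡_)

ℕ→ℚ : ℕ → ℚ
ℕ→ℚ n = + n / 1

-- A point of ℝ^{2r} (here with rational coordinates) given by its
-- λ-coordinates and μ-coordinates, indexed 1-based: coordinate i for 1 ≤ i ≤ r.
-- Values at indices outside 1..r are irrelevant (never inspected).
record Point : Set where
  constructor ⟨_∣_⟩
  field
    lam : ℕ → ℚ
    mu  : ℕ → ℚ
open Point public

psum : (ℕ → ℚ) → ℕ → ℚ
psum f zero    = 0ℚ
psum f (suc i) = psum f i + f (suc i)

-- The ray generator ((a-ℓ)^b, 0^{r-b} ; (a-ℓ)^ℓ, (b-ℓ)^{a-ℓ}, 0^{r-a}), 1-based.
genλ : ℕ → ℕ → ℕ → ℕ → ℕ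
genλ a b ℓ i = if i ≤ᵇ b then a ∸ ℓ else 0

genμ : ℕ → ℕ → ℕ → ℕ → ℕ
genμ a b ℓ i = if i ≤ᵇ ℓ then a ∸ ℓ else (if i ≤ᵇ a then b ∸ ℓ else 0)

-- Valid labels (a,b,ℓ) of vertices of P_r:
--   (a,b,ℓ) with 0 ≤ ℓ < b < a ≤ r, or (a,a,a) with 1 ≤ a ≤ r
--   (the latter stands for the rays with a = b, which are independent of ℓ).
data Label (r : ℕ) : ℕ → ℕ → ℕ → Set where
  distinct : ∀ {a b ℓ} → ℓ < b → b < a → a ≤ r → Label r a b ℓ
  equal    : ∀ {a} → 1 ≤ a → a ≤ r → Label r a a a

-- The generator vector of the extremal ray belonging to a label.
-- For a label (a,a,a) we use the representative ℓ = 0 (any ℓ < a gives the same ray).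
rayGen : ∀ {r a b ℓ} → Label r a b ℓ → Point
rayGen {a = a} {b} {ℓ} (distinct _ _ _) =
  ⟨ (λ i → ℕ→ℚ (genλ a b ℓ i)) ∣ (λ i → ℕ→ℚ (genμ a b ℓ i)) ⟩
rayGen {a = a} (equal _ _) =
  ⟨ (λ i → ℕ→ℚ (genλ a a 0 i)) ∣ (λ i → ℕ→ℚ (genμ a a 0 i)) ⟩

IsVertex : (r : ℕ) → ∀ {a b ℓ} → Label r a b ℓ → Point → Set
IsVertex r lab v =
  Σ ℚ (λ c → (0ℚ <ℚ c) ×
     ((i : ℕ) → 1 ≤ i → i ≤ r →
        (lam v i ≡ c * lam (rayGen lab) i) × (mu v i ≡ c * mu (rayGen lab) i)))
  × (psum (λ i → lam v i + mu v i) r ≡ 1ℚ)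

InH : (r : ℕ) → Point → ℕ → Set
InH r v i = if i <ᵇ r then (lam v i ≡ lam v (suc i)) else (lam v i ≡ 0ℚ)

InĤ : Point → ℕ → Set
InĤ v i = mu v i ≡ mu v (suc i)

InJ : Point → ℕ → Set
InJ v i = psum (lam v) i ≡ psum (mu v) i

{-# OPTIONS --safe #-}
-- The vertex is a positive rational multiple of its integral ray generator, so each of the
-- hyperplane conditions holds for the vertex iff it holds for the generator. The λ-part of the
-- generator is a single step of height a - ℓ ending at b, and its μ-part is the sum of a step of
-- height b - ℓ ending at a and one of height a - b ending at ℓ; consecutive coordinates agree
-- exactly away from the ends of these steps. The partial sums are Λ_j = min(j,b) (a - ℓ) and
-- M_j = min(j,a) (b - ℓ) + min(j,ℓ) (a - b), which agree for j ≤ ℓ and j ≥ a but not in between.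
module Submission where

open import Defs
open import Data.Nat
  using (ℕ; zero; suc; _+_; _*_; _∸_; _⊓_; _≤_; _<_; _≥_; _<ᵇ_; _≤ᵇ_; _≤?_; ≢-nonZero; z≤n; s≤s)
open import Data.Nat.Properties
open import Data.Nat.Tactic.RingSolver using (solve-∀)
open import Data.Nat.Divisibility using (∣1⇒≡1)
open import Data.Bool using (true; false; if_then_else_)
open import Data.Product using (_×_; _,_; proj₁; proj₂)
open import Data.Sum using (_⊎_; inj₁; inj₂; [_,_]′)
import Data.Sum as Sum
import Data.Integer as ℤ
import Data.Integer.Properties as ℤₚ
open import Data.Rational using (ℚ; mkℚ; 0ℚ; 1ℚ; 1/_; ↥_; >-nonZero; _/_)
  renaming (_+_ to _+ℚ_; _*_ to _*ℚ_; _<_ to _<ℚ_)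
import Data.Rational.Properties as ℚ
open import Relation.Nullary using (Dec; yes; no; contradiction)
open import Relation.Nullary.Reflects using (ofʸ; ofⁿ)
open import Relation.Binary.PropositionalEquality
  using (_≡_; _≢_; refl; sym; ≢-sym; trans; cong; cong₂; subst₂; module ≡-Reasoning)
open import Function.Bundles using (_⇔_; mk⇔; Equivalence)
open import Function.Properties.Equivalence using () renaming (trans to ⇔-trans)

ℕ→ℚ≡mkℚ : ∀ n → ℕ→ℚ n ≡ mkℚ (ℤ.+ n) 0 (λ {(_ , d∣1) → ∣1⇒≡1 d∣1})
ℕ→ℚ≡mkℚ n = ℚ.normalize-coprime _

ℕ→ℚ-injective : ∀ {m n} → ℕ→ℚ m ≡ ℕ→ℚ n → m ≡ n
ℕ→ℚ-injective {m} {n} eq =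
  ℤₚ.+-injective (cong ↥_ (trans (sym (ℕ→ℚ≡mkℚ m)) (trans eq (ℕ→ℚ≡mkℚ n))))

ℕ→ℚ-+ : ∀ m n → ℕ→ℚ (m + n) ≡ ℕ→ℚ m +ℚ ℕ→ℚ n
ℕ→ℚ-+ m n rewrite ℕ→ℚ≡mkℚ m | ℕ→ℚ≡mkℚ n =
  cong (_/ 1) (sym (cong₂ ℤ._+_ (ℤₚ.*-identityʳ (ℤ.+ m)) (ℤₚ.*-identityʳ (ℤ.+ n))))

*-cancelˡ-≡-pos : ∀ {c x y} → 0ℚ <ℚ c → c *ℚ x ≡ c *ℚ y → x ≡ y
*-cancelˡ-≡-pos {c} {x} {y} c>0 eq = begin
  x                  ≡⟨ ℚ.*-identityˡ x ⟨
  1ℚ *ℚ x            ≡⟨ cong (_*ℚ x) (ℚ.*-inverseˡ c) ⟨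
  (1/ c) *ℚ c *ℚ x   ≡⟨ ℚ.*-assoc (1/ c) c x ⟩
  (1/ c) *ℚ (c *ℚ x) ≡⟨ cong ((1/ c) *ℚ_) eq ⟩
  (1/ c) *ℚ (c *ℚ y) ≡⟨ ℚ.*-assoc (1/ c) c y ⟨
  (1/ c) *ℚ c *ℚ y   ≡⟨ cong (_*ℚ y) (ℚ.*-inverseˡ c) ⟩
  1ℚ *ℚ y            ≡⟨ ℚ.*-identityˡ y ⟩
  y                  ∎
  where open ≡-Reasoning
        instance _ = >-nonZero c>0

scaled-≡⇔ : ∀ {c m n} → 0ℚ <ℚ c → (c *ℚ ℕ→ℚ m ≡ c *ℚ ℕ→ℚ n) ⇔ (m ≡ n)
scaled-≡⇔ {c} c>0 = mk⇔ (λ eq → ℕ→ℚ-injective (*-cancelˡ-≡-pos c>0 eq)) (cong (λ k → c *ℚ ℕ→ℚ k))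

sumTo : (ℕ → ℕ) → ℕ → ℕ
sumTo g zero    = 0
sumTo g (suc j) = sumTo g j + g (suc j)

sumTo-+ : ∀ f g j → sumTo (λ i → f i + g i) j ≡ sumTo f j + sumTo g j
sumTo-+ f g zero    = refl
sumTo-+ f g (suc j) rewrite sumTo-+ f g j = interchange (sumTo f j) (sumTo g j) (f (suc j)) (g (suc j))
  where
  interchange : ∀ p q x y → p + q + (x + y) ≡ p + x + (q + y)
  interchange = solve-∀

sumTo-cong : ∀ {f g} → (∀ i → f (suc i) ≡ g (suc i)) → ∀ j → sumTo f j ≡ sumTo g j
sumTo-cong f≗g zero    = refl
sumTo-cong f≗g (suc j) = cong₂ _+_ (sumTo-cong f≗g j) (f≗g j)

psum-scaled : ∀ {r c f g} → (∀ i → 1 ≤ i → i ≤ r → f i ≡ c *ℚ ℕ→ℚ (g i)) →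
  ∀ j → j ≤ r → psum f j ≡ c *ℚ ℕ→ℚ (sumTo g j)
psum-scaled {c = c} f≈cg zero    _    = sym (ℚ.*-zeroʳ c)
psum-scaled {r} {c} {f} {g} f≈cg (suc j) 1+j≤r = begin
  psum f j +ℚ f (suc j)                         ≡⟨ cong₂ _+ℚ_ (psum-scaled {r} {c} {f} {g} f≈cg j (<⇒≤ 1+j≤r))
                                                              (f≈cg (suc j) (s≤s z≤n) 1+j≤r) ⟩
  c *ℚ ℕ→ℚ (sumTo g j) +ℚ c *ℚ ℕ→ℚ (g (suc j)) ≡⟨ ℚ.*-distribˡ-+ c _ _ ⟨
  c *ℚ (ℕ→ℚ (sumTo g j) +ℚ ℕ→ℚ (g (suc j)))    ≡⟨ cong (c *ℚ_) (ℕ→ℚ-+ (sumTo g j) (g (suc j))) ⟨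
  c *ℚ ℕ→ℚ (sumTo g (suc j))                    ∎
  where open ≡-Reasoning

step : ℕ → ℕ → ℕ → ℕ
step m x i = if i ≤ᵇ m then x else 0

step-≤ : ∀ {m i} x → i ≤ m → step m x i ≡ x
step-≤ {m} {i} x i≤m with i ≤ᵇ m | ≤ᵇ-reflects-≤ i m
... | true  | _       = refl
... | false | ofⁿ i≰m = contradiction i≤m i≰m

step-> : ∀ {m i} x → m < i → step m x i ≡ 0
step-> {m} {i} x m<i with i ≤ᵇ m | ≤ᵇ-reflects-≤ i m
... | true  | ofʸ i≤m = contradiction i≤m (<⇒≱ m<i)
... | false | _       = refl

step-flat : ∀ {m i} x → m ≢ i → step m x i ≡ step m x (suc i)
step-flat {m} {i} x m≢i with i ≤? m
... | yes i≤m = trans (step-≤ x i≤m) (sym (step-≤ x (≤∧≢⇒< i≤m (≢-sym m≢i))))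
... | no  i≰m = trans (step-> x (≰⇒> i≰m)) (sym (step-> x (m≤n⇒m≤1+n (≰⇒> i≰m))))

step-flat⇔ : ∀ {m x i} → x ≢ 0 → (step m x i ≡ step m x (suc i)) ⇔ (m ≢ i)
step-flat⇔ {m} {x} x≢0 = mk⇔ drops-at-m (step-flat x)
  where
  drops-at-m : ∀ {i} → step m x i ≡ step m x (suc i) → m ≢ i
  drops-at-m eq refl = x≢0 (trans (sym (step-≤ x (≤-refl {m}))) (trans eq (step-> x (n<1+n m))))

sumTo-step : ∀ m x j → sumTo (step m x) j ≡ (j ⊓ m) * x
sumTo-step m x zero = refl
sumTo-step m x (suc j) with suc j ≤? m
... | yes 1+j≤m rewrite sumTo-step m x j | m≤n⇒m⊓n≡m (<⇒≤ 1+j≤m) | m≤n⇒m⊓n≡m 1+j≤m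
                      | step-≤ x 1+j≤m = +-comm (j * x) x
... | no  1+j≰m rewrite sumTo-step m x j | m≥n⇒m⊓n≡n (≤-pred (≰⇒> 1+j≰m)) | m≥n⇒m⊓n≡n (<⇒≤ (≰⇒> 1+j≰m))
                      | step-> x (≰⇒> 1+j≰m) = +-identityʳ (m * x)

two-steps-flat⇔ : ∀ {m n x y k} → m ≢ n → x ≢ 0 → y ≢ 0 →
  (step m x k + step n y k ≡ step m x (suc k) + step n y (suc k)) ⇔ ((m ≢ k) × (n ≢ k))
two-steps-flat⇔ {m} {n} {x} {y} {k} m≢n x≢0 y≢0 =
  mk⇔ (λ eq → no-drop-at-m eq , no-drop-at-n eq) (λ (m≢k , n≢k) → cong₂ _+_ (step-flat x m≢k) (step-flat y n≢k))
  where
  no-drop-at-m : step m x k + step n y k ≡ step m x (suc k) + step n y (suc k) → m ≢ k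
  no-drop-at-m eq m≡k = Equivalence.to (step-flat⇔ x≢0)
    (+-cancelʳ-≡ _ _ _ (trans (cong (step m x k +_) n-flat) eq)) m≡k
    where n-flat = sym (step-flat y (λ n≡k → m≢n (trans m≡k (sym n≡k))))
  no-drop-at-n : step m x k + step n y k ≡ step m x (suc k) + step n y (suc k) → n ≢ k
  no-drop-at-n eq n≡k = Equivalence.to (step-flat⇔ y≢0)
    (+-cancelˡ-≡ _ _ _ (trans (cong (_+ step n y k) m-flat) eq)) n≡k
    where m-flat = sym (step-flat x (λ m≡k → m≢n (trans m≡k (sym n≡k))))

∸-split : ∀ {ℓ b a} → ℓ ≤ b → b ≤ a → a ∸ ℓ ≡ (b ∸ ℓ) + (a ∸ b)
∸-split {ℓ} {b} {a} ℓ≤b b≤a = begin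
  a ∸ ℓ             ≡⟨ cong (_∸ ℓ) (m∸n+n≡m b≤a) ⟨
  (a ∸ b + b) ∸ ℓ   ≡⟨ +-∸-assoc (a ∸ b) ℓ≤b ⟩
  a ∸ b + (b ∸ ℓ)   ≡⟨ +-comm (a ∸ b) (b ∸ ℓ) ⟩
  b ∸ ℓ + (a ∸ b)   ∎
  where open ≡-Reasoning

genμ≡steps : ∀ {a b ℓ} → ℓ ≤ b → b ≤ a → ∀ i → genμ a b ℓ i ≡ step a (b ∸ ℓ) i + step ℓ (a ∸ b) i
genμ≡steps {a} {b} {ℓ} ℓ≤b b≤a i with i ≤ᵇ ℓ | ≤ᵇ-reflects-≤ i ℓ
... | true  | ofʸ i≤ℓ rewrite step-≤ (b ∸ ℓ) (≤-trans i≤ℓ (≤-trans ℓ≤b b≤a))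
  = ∸-split ℓ≤b b≤a
... | false | ofⁿ _ = sym (+-identityʳ _)

genμ-flat⇔ : ∀ {a b ℓ k} → ℓ < b → b < a → (genμ a b ℓ k ≡ genμ a b ℓ (suc k)) ⇔ ((a ≢ k) × (ℓ ≢ k))
genμ-flat⇔ {a} {b} {ℓ} {k} ℓ<b b<a
  rewrite genμ≡steps (<⇒≤ ℓ<b) (<⇒≤ b<a) k | genμ≡steps (<⇒≤ ℓ<b) (<⇒≤ b<a) (suc k)
  = two-steps-flat⇔ (>⇒≢ (<-trans ℓ<b b<a)) (m>n⇒m∸n≢0 ℓ<b) (m>n⇒m∸n≢0 b<a)

partialSums-agree⇔ : ∀ {ℓ b a E D j} → ℓ + E ≡ b → b + D ≡ a → E ≢ 0 → D ≢ 0 →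
  ((j ⊓ b) * (E + D) ≡ (j ⊓ a) * E + (j ⊓ ℓ) * D) ⇔ ((j ≤ ℓ) ⊎ (a ≤ j))
partialSums-agree⇔ {ℓ} {E = E} {D} {j} refl refl E≢0 D≢0 = by-position (j ≤? ℓ) (a ≤? j)
  where
  b = ℓ + E
  a = ℓ + E + D

  corner-identity : ∀ l e d → (l + e) * (e + d) ≡ (l + e + d) * e + l * d
  corner-identity = solve-∀

  corner : b * (E + D) ≡ a * E + ℓ * D
  corner = corner-identity ℓ E D

  agree-below : j ≤ ℓ → (j ⊓ b) * (E + D) ≡ (j ⊓ a) * E + (j ⊓ ℓ) * D
  agree-below j≤ℓ rewrite m≤n⇒m⊓n≡m j≤ℓ | m≤n⇒m⊓n≡m (m≤n⇒m≤n+o E j≤ℓ)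
                        | m≤n⇒m⊓n≡m (m≤n⇒m≤n+o D (m≤n⇒m≤n+o E j≤ℓ)) = *-distribˡ-+ j E D

  agree-above : a ≤ j → (j ⊓ b) * (E + D) ≡ (j ⊓ a) * E + (j ⊓ ℓ) * D
  agree-above a≤j rewrite m≥n⇒m⊓n≡n a≤j | m≥n⇒m⊓n≡n (m+n≤o⇒m≤o b a≤j)
                        | m≥n⇒m⊓n≡n (m+n≤o⇒m≤o ℓ (m+n≤o⇒m≤o b a≤j)) = corner

  -- Strictly between ℓ and a the difference of the two sides is (j - ℓ) D up to b and (a - j) E after b.
  differ-between : ℓ < j → j < a → (j ⊓ b) * (E + D) ≢ (j ⊓ a) * E + (j ⊓ ℓ) * D
  differ-between ℓ<j j<a eq rewrite m≤n⇒m⊓n≡m (<⇒≤ j<a) | m≥n⇒m⊓n≡n (<⇒≤ ℓ<j) with j ≤? b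
  ... | yes j≤b rewrite m≤n⇒m⊓n≡m j≤b = >⇒≢ ℓ<j (*-cancelʳ-≡ j ℓ D {{≢-nonZero D≢0}}
          (+-cancelˡ-≡ (j * E) _ _ (trans (sym (*-distribˡ-+ j E D)) eq)))
  ... | no j≰b  rewrite m≥n⇒m⊓n≡n (<⇒≤ (≰⇒> j≰b)) = >⇒≢ j<a (*-cancelʳ-≡ a j E {{≢-nonZero E≢0}}
          (+-cancelʳ-≡ (ℓ * D) _ _ (trans (sym corner) eq)))

  by-position : Dec (j ≤ ℓ) → Dec (a ≤ j) →
    ((j ⊓ b) * (E + D) ≡ (j ⊓ a) * E + (j ⊓ ℓ) * D) ⇔ ((j ≤ ℓ) ⊎ (a ≤ j))
  by-position (yes j≤ℓ) _         = mk⇔ (λ _ → inj₁ j≤ℓ) (λ _ → agree-below j≤ℓ)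
  by-position (no _)    (yes a≤j) = mk⇔ (λ _ → inj₂ a≤j) (λ _ → agree-above a≤j)
  by-position (no j≰ℓ)  (no a≰j)  = mk⇔ (λ eq → contradiction eq (differ-between (≰⇒> j≰ℓ) (≰⇒> a≰j)))
                                      [ (λ j≤ℓ → contradiction j≤ℓ j≰ℓ) , (λ a≤j → contradiction a≤j a≰j) ]′

sumTo-genλ≡genμ⇔ : ∀ {a b ℓ} → ℓ < b → b < a → ∀ j →
  (sumTo (genλ a b ℓ) j ≡ sumTo (genμ a b ℓ) j) ⇔ ((j ≤ ℓ) ⊎ (a ≤ j))
sumTo-genλ≡genμ⇔ {a} {b} {ℓ} ℓ<b b<a j =
  subst₂ (λ p q → (p ≡ q) ⇔ ((j ≤ ℓ) ⊎ (a ≤ j))) (sym sumTo-genλ) (sym sumTo-genμ)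
    (partialSums-agree⇔ (m+[n∸m]≡n ℓ≤b) (m+[n∸m]≡n b≤a) (m>n⇒m∸n≢0 ℓ<b) (m>n⇒m∸n≢0 b<a))
  where
  open ≡-Reasoning
  ℓ≤b = <⇒≤ ℓ<b
  b≤a = <⇒≤ b<a

  sumTo-genλ : sumTo (genλ a b ℓ) j ≡ (j ⊓ b) * (b ∸ ℓ + (a ∸ b))
  sumTo-genλ = trans (sumTo-step b (a ∸ ℓ) j) (cong ((j ⊓ b) *_) (∸-split ℓ≤b b≤a))

  sumTo-genμ : sumTo (genμ a b ℓ) j ≡ (j ⊓ a) * (b ∸ ℓ) + (j ⊓ ℓ) * (a ∸ b)
  sumTo-genμ = begin
    sumTo (genμ a b ℓ) j                                   ≡⟨ sumTo-cong (λ i → genμ≡steps ℓ≤b b≤a (suc i)) j ⟩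
    sumTo (λ i → step a (b ∸ ℓ) i + step ℓ (a ∸ b) i) j    ≡⟨ sumTo-+ (step a (b ∸ ℓ)) (step ℓ (a ∸ b)) j ⟩
    sumTo (step a (b ∸ ℓ)) j + sumTo (step ℓ (a ∸ b)) j    ≡⟨ cong₂ _+_ (sumTo-step a (b ∸ ℓ) j) (sumTo-step ℓ (a ∸ b) j) ⟩
    (j ⊓ a) * (b ∸ ℓ) + (j ⊓ ℓ) * (a ∸ b)                  ∎

module OnRay {r : ℕ} {v : Point} {c : ℚ} (c>0 : 0ℚ <ℚ c) (b x : ℕ) (gμ : ℕ → ℕ)
  (on-ray : ∀ i → 1 ≤ i → i ≤ r → (lam v i ≡ c *ℚ ℕ→ℚ (step b x i)) × (mu v i ≡ c *ℚ ℕ→ℚ (gμ i))) where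

  lam-on-ray : ∀ i → 1 ≤ i → i ≤ r → lam v i ≡ c *ℚ ℕ→ℚ (step b x i)
  lam-on-ray i 1≤i i≤r = proj₁ (on-ray i 1≤i i≤r)

  mu-on-ray : ∀ i → 1 ≤ i → i ≤ r → mu v i ≡ c *ℚ ℕ→ℚ (gμ i)
  mu-on-ray i 1≤i i≤r = proj₂ (on-ray i 1≤i i≤r)

  scaled-coords⇔ : ∀ {p q m n} → p ≡ c *ℚ ℕ→ℚ m → q ≡ c *ℚ ℕ→ℚ n → (p ≡ q) ⇔ (m ≡ n)
  scaled-coords⇔ refl refl = scaled-≡⇔ c>0

  InH⇔ : b ≤ r → x ≢ 0 → ∀ i → 1 ≤ i → i ≤ r → InH r v i ⇔ (b ≢ i)
  InH⇔ b≤r x≢0 i 1≤i i≤r = ⇔-trans InH⇔flat (step-flat⇔ x≢0)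
    where
    InH⇔flat : InH r v i ⇔ (step b x i ≡ step b x (suc i))
    InH⇔flat with i <ᵇ r | <ᵇ-reflects-< i r
    ... | true  | ofʸ i<r = scaled-coords⇔ (lam-on-ray i 1≤i i≤r) (lam-on-ray (suc i) (s≤s z≤n) i<r)
    -- Here i = r, and the generator vanishes at r + 1 because b ≤ r.
    ... | false | ofⁿ i≮r = scaled-coords⇔ (lam-on-ray i 1≤i i≤r) (sym (begin
      c *ℚ ℕ→ℚ (step b x (suc i)) ≡⟨ cong (λ n → c *ℚ ℕ→ℚ n) (step-> x (s≤s (≤-trans b≤r (≮⇒≥ i≮r)))) ⟩
      c *ℚ 0ℚ                     ≡⟨ ℚ.*-zeroʳ c ⟩
      0ℚ                          ∎))
      where open ≡-Reasoning

  InĤ⇔ : ∀ k → 1 ≤ k → k < r → InĤ v k ⇔ (gμ k ≡ gμ (suc k))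
  InĤ⇔ k 1≤k k<r = scaled-coords⇔ (mu-on-ray k 1≤k (<⇒≤ k<r)) (mu-on-ray (suc k) (s≤s z≤n) k<r)

  InJ⇔ : ∀ j → j ≤ r → InJ v j ⇔ (sumTo (step b x) j ≡ sumTo gμ j)
  InJ⇔ j j≤r = scaled-coords⇔ (psum-scaled {c = c} {g = step b x} lam-on-ray j j≤r)
                              (psum-scaled {c = c} {g = gμ} mu-on-ray j j≤r)

proposition3p5 : (r : ℕ) → 1 ≤ r → {a b ℓ : ℕ} → (lab : Label r a b ℓ) →
    (v : Point) → IsVertex r lab v →
      ((i : ℕ) → 1 ≤ i → i ≤ r → (InH r v i ⇔ (b ≢ i)))
      × ((k : ℕ) → 1 ≤ k → k < r → (InĤ v k ⇔ ((a ≢ k) × (ℓ ≢ k))))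
      × ((j : ℕ) → 1 ≤ j → j < r → (InJ v j ⇔ ((j ≤ ℓ) ⊎ (j ≥ a) ⊎ (a ≡ b))))
proposition3p5 r _ {a} {b} {ℓ} (distinct ℓ<b b<a a≤r) v ((c , c>0 , on-ray) , _) =
    InH⇔ (≤-trans (<⇒≤ b<a) a≤r) (m>n⇒m∸n≢0 (<-trans ℓ<b b<a))
  , (λ k 1≤k k<r → ⇔-trans (InĤ⇔ k 1≤k k<r) (genμ-flat⇔ ℓ<b b<a))
  , (λ j _ j<r → ⇔-trans (InJ⇔ j (<⇒≤ j<r)) (⇔-trans (sumTo-genλ≡genμ⇔ ℓ<b b<a j) extend-by-a≡b))
  where
  open OnRay c>0 b (a ∸ ℓ) (genμ a b ℓ) on-ray
  extend-by-a≡b : ∀ {P Q} → (P ⊎ Q) ⇔ (P ⊎ Q ⊎ (a ≡ b))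
  extend-by-a≡b = mk⇔ (Sum.map₂ inj₁) [ inj₁ , [ inj₂ , (λ a≡b → contradiction a≡b (>⇒≢ b<a)) ]′ ]′
proposition3p5 r _ {a} (equal 1≤a a≤r) v ((c , c>0 , on-ray) , _) =
    InH⇔ a≤r (>⇒≢ 1≤a)
  , (λ k 1≤k k<r → ⇔-trans (InĤ⇔ k 1≤k k<r) (⇔-trans (step-flat⇔ (>⇒≢ 1≤a)) (mk⇔ (λ p → p , p) proj₁)))
  , (λ j _ j<r → mk⇔ (λ _ → inj₂ (inj₂ refl)) (λ _ → Equivalence.from (InJ⇔ j (<⇒≤ j<r)) refl))
  where
  -- For the representative ℓ = 0 the μ-generator of (a,a,a) equals its λ-generator at every i ≥ 1.
  on-ray′ : ∀ i → 1 ≤ i → i ≤ r → (lam v i ≡ c *ℚ ℕ→ℚ (step a a i)) × (mu v i ≡ c *ℚ ℕ→ℚ (step a a i))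
  on-ray′ zero    ()
  on-ray′ (suc i) = on-ray (suc i)
  open OnRay c>0 a a (step a a) on-ray′
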